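{- Let $m\geq 13$ and $k\geq1$ be integers and let $c(x)=1+\sum_{j\in\{1,2,5,6\}}(x^j+x^{m-j})\in\mathbb{F}_2[x]$. Then $\gcd(c(x^k),x^m-1)=1$ in $\mathbb{F}_2[x]$ if and only if $\gcd(m,3k)=\gcd(m,k)$.
   Context: In the paper's terminology this says $\{1,2,5,6\}$ is a QBF-set with respect to $(n,k)$, $n=em$: a set $\mathcal{C}\subseteq\{1,\dots,\lfloor\frac{m-1}{2}\rfloor\}$ is a QBF-set if $c(x)=1+\sum_{j\in\mathcal{C}}(x^j+x^{m-j})$ satisfies $\gcd(c(x^k),x^m-1)=1$ over $\mathbb{F}_2$. -}

module Defs where

open import Data.Bool using (Bool; true; false; _xor_; _∧_)
open import Data.List using (List; []; _∷_; replicate; _++_; [_]; foldr)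
open import Data.Nat using (ℕ; zero; suc; _∸_)
open import Data.Product using (∃)
open import Relation.Binary.PropositionalEquality using (_≡_)

-- Polynomials over 𝔽₂ = Bool (xor as +, ∧ as *), as coefficient lists,
-- lowest degree first.  Trailing zero coefficients are allowed; equality
-- of polynomials is coefficientwise (_≈ₚ_).
Poly : Set
Poly = List Bool

coeff : Poly → ℕ → Bool
coeff []      _       = false
coeff (a ∷ f) zero    = a
coeff (a ∷ f) (suc i) = coeff f i

_≈ₚ_ : Poly → Poly → Set
f ≈ₚ g = ∀ i → coeff f i ≡ coeff g i

infixl 6 _+ₚ_
infixl 7 _*ₚ_

_+ₚ_ : Poly → Poly → Poly
[]      +ₚ g       = g
(a ∷ f) +ₚ []      = a ∷ f
(a ∷ f) +ₚ (b ∷ g) = (a xor b) ∷ (f +ₚ g)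

scaleₚ : Bool → Poly → Poly
scaleₚ false _ = []
scaleₚ true  g = g

_*ₚ_ : Poly → Poly → Poly
[]      *ₚ g = []
(a ∷ f) *ₚ g = scaleₚ a g +ₚ (false ∷ (f *ₚ g))

oneₚ : Poly
oneₚ = true ∷ []

X^ : ℕ → Poly
X^ n = replicate n false ++ [ true ]

compX^ : ℕ → Poly → Poly
compX^ k = foldr (λ a acc → (a ∷ []) +ₚ (X^ k *ₚ acc)) []

_∣ₚ_ : Poly → Poly → Set
d ∣ₚ f = ∃ λ q → (q *ₚ d) ≈ₚ f

GcdOne : Poly → Poly → Set
GcdOne f g = ∀ d → d ∣ₚ f → d ∣ₚ g → d ∣ₚ oneₚ

cPoly : ℕ → List ℕ → Poly
cPoly m C = foldr (λ j acc → acc +ₚ (X^ j +ₚ X^ (m ∸ j))) oneₚ C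

-- x^m - 1 = x^m + 1 over 𝔽₂
xm-1 : ℕ → Poly
xm-1 m = X^ m +ₚ oneₚ

module Submission where

-- Write y = x^k and Φ₃ = 1 + x + x².  Modulo x^m - 1 we have y^m = 1, so y^6 c(y) ≡ P(y) where
-- P = x^6 + (x^12 + 1) + (x^11 + x) + (x^8 + x^4) + (x^7 + x^5) = Φ₃³ Φ₃(x³).
-- A root z of Φ₃ modulo an ideal satisfies z³ = 1; if moreover z^N = 1 with 3 ∤ N then z = 1,
-- and Φ₃(1) = 1 over 𝔽₂, so the ideal is trivial.
-- If g = gcd(m,k) = gcd(m,3k), then y^(m/g) = 1 with 3 ∤ m/g, so Φ₃(y) and Φ₃(y³) are invertible
-- modulo any common divisor d of c(y) and x^m - 1; since d ∣ P(y), d ∣ 1.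
-- Otherwise gcd(m,3k) = 3g, so 3g ∣ m and k = Kg with 3 ∤ K.  Then Φ₃(x^g), of degree 2g > 0,
-- divides x^3g - 1, hence x^m - 1, and Φ₃(x^k), hence P(y) and c(y).

open import Defs

open import Algebra.Bundles using (CommutativeRing; CommutativeSemigroup)
import Algebra.Properties.CommutativeSemigroup
import Algebra.Properties.Semiring.Exp
open import Data.Bool using (Bool; true; false; _xor_; _∧_; not; T)
open import Data.Bool.Properties using (xor-assoc; xor-comm; xor-identityʳ; xor-same)
open import Data.Empty using (⊥-elim)
open import Data.List using (List; []; _∷_; foldr)
open import Data.List.Relation.Unary.All using (All; []; _∷_; all?)
open import Data.Nat as ℕ using (ℕ; zero; suc; _≤_; _∸_; z≤n; s≤s; NonZero; ≢-nonZero)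
import Data.Nat.Properties as ℕ
open import Data.Nat.DivMod using (_%_; _/_; m≡m%n+[m/n]*n; m%n<n)
open import Data.Nat.Divisibility
  using (_∣_; divides; m%n≡0⇒n∣m; n∣m*n; ∣n⇒∣m*n; ∣⇒≤; *-monoʳ-∣; *-monoˡ-∣; *-cancelʳ-∣)
open import Data.Nat.GCD
  using (gcd; gcd-greatest; gcd[m,n]∣m; gcd[m,n]∣n; gcd[m,n]≢0; c*gcd[m,n]≡gcd[cm,cn])
open import Data.Nat.Primality using (prime?; prime⇒irreducible)
open import Data.Product using (_×_; _,_; proj₁; proj₂; ∃; ∃₂)
open import Data.Sum using (_⊎_; inj₁; inj₂; [_,_]′)
open import Function using (id)
open import Function.Bundles using (_⇔_; mk⇔; Equivalence)
open import Level using (0ℓ; _⊔_) renaming (suc to lsuc)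
open import Relation.Binary.Bundles using (Setoid)
import Relation.Binary.Reasoning.Setoid
open import Relation.Binary.PropositionalEquality as ≡ using (_≡_; _≢_; refl; cong; cong₂)
open import Relation.Nullary using (¬_)
open import Relation.Nullary.Decidable using (from-yes; decidable-stable)

-- Ideals of a commutative ring and congruence modulo an ideal

module IdealTheory {c ℓ} (R : CommutativeRing c ℓ) where
  open CommutativeRing R renaming (refl to ≈-refl)
  open import Algebra.Properties.Ring ring
    using (-1*x≈-x; -0#≈0#; ⁻¹-anti-homo‿-; -‿+-comm; -‿anti-homo-+; x[y-z]≈xy-xz; [y-z]x≈yx-zx; x≈y⇒x∙y⁻¹≈ε)
  open Algebra.Properties.CommutativeSemigroup +-commutativeSemigroup using (interchange)
  open import Relation.Binary.Reasoning.Setoid setoid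

  record Ideal : Set (lsuc (c ⊔ ℓ)) where
    field
      Member   : Carrier → Set (c ⊔ ℓ)
      ∈-resp   : ∀ {x y} → x ≈ y → Member x → Member y
      0∈       : Member 0#
      +-closed : ∀ {x y} → Member x → Member y → Member (x + y)
      *-closed : ∀ r {x} → Member x → Member (r * x)

  infix 4 _∈_ _≋_mod_

  _∈_ : Carrier → Ideal → Set (c ⊔ ℓ)
  x ∈ I = Ideal.Member I x

  -- A record, so that x and y can be inferred from x ≋ y mod I.
  record _≋_mod_ (x y : Carrier) (I : Ideal) : Set (c ⊔ ℓ) where
    constructor mk≋
    field difference∈ : x - y ∈ I

  module _ (I : Ideal) where
    open Ideal I

    -‿closed : ∀ {x} → x ∈ I → - x ∈ I
    -‿closed {x} x∈I = ∈-resp (-1*x≈-x x) (*-closed (- 1#) x∈I)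

    *-closedʳ : ∀ r {x} → x ∈ I → x * r ∈ I
    *-closedʳ r {x} x∈I = ∈-resp (*-comm r x) (*-closed r x∈I)

    ∈⇒≋0 : ∀ {x} → x ∈ I → x ≋ 0# mod I
    ∈⇒≋0 {x} x∈I = mk≋ (∈-resp (sym (trans (+-congˡ -0#≈0#) (+-identityʳ x))) x∈I)

    ≋0⇒∈ : ∀ {x} → x ≋ 0# mod I → x ∈ I
    ≋0⇒∈ {x} (mk≋ x-0∈I) = ∈-resp (trans (+-congˡ -0#≈0#) (+-identityʳ x)) x-0∈I

    ≈⇒≋ : ∀ {x y} → x ≈ y → x ≋ y mod I
    ≈⇒≋ x≈y = mk≋ (∈-resp (sym (x≈y⇒x∙y⁻¹≈ε x≈y)) 0∈)

    ≋-sym : ∀ {x y} → x ≋ y mod I → y ≋ x mod I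
    ≋-sym {x} {y} (mk≋ x-y∈I) = mk≋ (∈-resp (⁻¹-anti-homo‿- x y) (-‿closed x-y∈I))

    ≋-trans : ∀ {x y z} → x ≋ y mod I → y ≋ z mod I → x ≋ z mod I
    ≋-trans {x} {y} {z} (mk≋ x-y∈I) (mk≋ y-z∈I) = mk≋ (∈-resp telescope (+-closed x-y∈I y-z∈I))
      where
      telescope : (x - y) + (y - z) ≈ x - z
      telescope = begin
        (x - y) + (y - z)   ≈⟨ +-assoc x (- y) (y - z) ⟩
        x + (- y + (y - z)) ≈⟨ +-congˡ (+-assoc (- y) y (- z)) ⟨
        x + ((- y + y) - z) ≈⟨ +-congˡ (+-congʳ (-‿inverseˡ y)) ⟩
        x + (0# - z)        ≈⟨ +-congˡ (+-identityˡ (- z)) ⟩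
        x - z               ∎

    ≋-+-cong : ∀ {x y u v} → x ≋ y mod I → u ≋ v mod I → x + u ≋ y + v mod I
    ≋-+-cong {x} {y} {u} {v} (mk≋ x-y∈I) (mk≋ u-v∈I) = mk≋ (∈-resp regroup (+-closed x-y∈I u-v∈I))
      where
      regroup : (x - y) + (u - v) ≈ (x + u) - (y + v)
      regroup = trans (interchange x (- y) u (- v)) (+-congˡ (-‿+-comm y v))

    ≋-*-cong : ∀ {x y u v} → x ≋ y mod I → u ≋ v mod I → x * u ≋ y * v mod I
    ≋-*-cong {x} {y} {u} {v} (mk≋ x-y∈I) (mk≋ u-v∈I) =
      ≋-trans (mk≋ (∈-resp ([y-z]x≈yx-zx u x y) (*-closedʳ u x-y∈I)))
              (mk≋ (∈-resp (x[y-z]≈xy-xz y u v) (*-closed y u-v∈I)))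

    ≋--‿cong : ∀ {x y} → x ≋ y mod I → - x ≋ - y mod I
    ≋--‿cong {x} {y} (mk≋ x-y∈I) = mk≋ (∈-resp (trans (-‿anti-homo-+ x (- y)) (+-comm _ _)) (-‿closed x-y∈I))

    quotientRing : CommutativeRing c (c ⊔ ℓ)
    quotientRing = record
      { Carrier = Carrier ; _≈_ = _≋_mod I ; _+_ = _+_ ; _*_ = _*_ ; -_ = -_ ; 0# = 0# ; 1# = 1#
      ; isCommutativeRing = record
        { isRing = record
          { +-isAbelianGroup = record
            { isGroup = record
              { isMonoid = record
                { isSemigroup = record
                  { isMagma = record
                    { isEquivalence = record { refl = ≈⇒≋ ≈-refl ; sym = ≋-sym ; trans = ≋-trans }
                    ; ∙-cong = ≋-+-cong }
                  ; assoc = λ x y z → ≈⇒≋ (+-assoc x y z) }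
                ; identity = (λ x → ≈⇒≋ (+-identityˡ x)) , (λ x → ≈⇒≋ (+-identityʳ x)) }
              ; inverse = (λ x → ≈⇒≋ (-‿inverseˡ x)) , (λ x → ≈⇒≋ (-‿inverseʳ x))
              ; ⁻¹-cong = ≋--‿cong }
            ; comm = λ x y → ≈⇒≋ (+-comm x y) }
          ; *-cong = ≋-*-cong
          ; *-assoc = λ x y z → ≈⇒≋ (*-assoc x y z)
          ; *-identity = (λ x → ≈⇒≋ (*-identityˡ x)) , (λ x → ≈⇒≋ (*-identityʳ x))
          ; distrib = (λ x y z → ≈⇒≋ (distribˡ x y z)) , (λ x y z → ≈⇒≋ (distribʳ x y z)) }
        ; *-comm = λ x y → ≈⇒≋ (*-comm x y) } }

  adjoin : Ideal → Carrier → Ideal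
  adjoin I a = record
    { Member   = λ x → ∃₂ λ i r → i ∈ I × x ≈ i + r * a
    ; ∈-resp   = λ { x≈y (i , r , i∈I , x≈i+ra) → i , r , i∈I , trans (sym x≈y) x≈i+ra }
    ; 0∈       = 0# , 0# , 0∈ , sym (trans (+-identityˡ _) (zeroˡ a))
    ; +-closed = λ { {x} {y} (i , r , i∈I , x≈) (j , s , j∈I , y≈) →
        i + j , r + s , +-closed i∈I j∈I ,
        trans (+-cong x≈ y≈) (trans (interchange i (r * a) j (s * a)) (+-congˡ (sym (distribʳ a r s)))) }
    ; *-closed = λ { t {x} (i , r , i∈I , x≈) →
        t * i , t * r , *-closed t i∈I ,
        trans (*-congˡ x≈) (trans (distribˡ t i (r * a)) (+-congˡ (sym (*-assoc t r a)))) }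
    }
    where open Ideal I

  a∈adjoin : ∀ I a → a ∈ adjoin I a
  a∈adjoin I a = 0# , 1# , Ideal.0∈ I , sym (trans (+-identityˡ _) (*-identityˡ a))

  ⊆-adjoin : ∀ I a {x} → x ∈ I → x ∈ adjoin I a
  ⊆-adjoin I a {x} x∈I = x , 0# , x∈I , sym (trans (+-congˡ (zeroˡ a)) (+-identityʳ x))

  ≋-adjoin : ∀ I a {x y} → x ≋ y mod I → x ≋ y mod adjoin I a
  ≋-adjoin I a (mk≋ x-y∈I) = mk≋ (⊆-adjoin I a x-y∈I)

  invertible-cancel : ∀ I a {b} → 1# ∈ adjoin I a → a * b ∈ I → b ∈ I
  invertible-cancel I a {b} (i , r , i∈I , 1≈i+ra) ab∈I =
    ∈-resp expand (+-closed (*-closedʳ I b i∈I) (*-closed r ab∈I))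
    where
    open Ideal I
    expand : i * b + r * (a * b) ≈ b
    expand = begin
      i * b + r * (a * b) ≈⟨ +-congˡ (*-assoc r a b) ⟨
      i * b + r * a * b   ≈⟨ distribʳ b i (r * a) ⟨
      (i + r * a) * b     ≈⟨ *-congʳ 1≈i+ra ⟨
      1# * b              ≈⟨ *-identityˡ b ⟩
      b                   ∎

module PowerTheory {c ℓ} (R : CommutativeRing c ℓ) where
  open CommutativeRing R renaming (refl to ≈-refl)
  open import Algebra.Properties.Semiring.Exp semiring using (_^_; ^-homo-*; ^-assocʳ; ^-congʳ)
  open import Relation.Binary.Reasoning.Setoid setoid

  1#^n≈1# : ∀ n → 1# ^ n ≈ 1#
  1#^n≈1# zero    = ≈-refl
  1#^n≈1# (suc n) = trans (*-identityˡ _) (1#^n≈1# n)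

  x^n≈x^[n%m]*[x^m]^[n/m] : ∀ x m n .{{_ : NonZero m}} → x ^ n ≈ x ^ (n % m) * (x ^ m) ^ (n / m)
  x^n≈x^[n%m]*[x^m]^[n/m] x m n = begin
    x ^ n                               ≈⟨ ^-congʳ x (m≡m%n+[m/n]*n n m) ⟩
    x ^ (n % m ℕ.+ (n / m) ℕ.* m)       ≈⟨ ^-homo-* x (n % m) _ ⟩
    x ^ (n % m) * x ^ ((n / m) ℕ.* m)   ≈⟨ *-congˡ (^-congʳ x (ℕ.*-comm (n / m) m)) ⟩
    x ^ (n % m) * x ^ (m ℕ.* (n / m))   ≈⟨ *-congˡ (^-assocʳ x m (n / m)) ⟨
    x ^ (n % m) * (x ^ m) ^ (n / m)     ∎

  x^i*[x^j+x^[m∸j]]≈x^[i+j]+x^m*x^[i∸j] : ∀ x m i j → j ≤ i → j ≤ m →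
    x ^ i * (x ^ j + x ^ (m ∸ j)) ≈ x ^ (i ℕ.+ j) + x ^ m * x ^ (i ∸ j)
  x^i*[x^j+x^[m∸j]]≈x^[i+j]+x^m*x^[i∸j] x m i j j≤i j≤m = begin
    x ^ i * (x ^ j + x ^ (m ∸ j))             ≈⟨ distribˡ (x ^ i) _ _ ⟩
    x ^ i * x ^ j + x ^ i * x ^ (m ∸ j)       ≈⟨ +-cong (^-homo-* x i j) (^-homo-* x i (m ∸ j)) ⟨
    x ^ (i ℕ.+ j) + x ^ (i ℕ.+ (m ∸ j))       ≈⟨ +-congˡ (^-congʳ x exponent) ⟩
    x ^ (i ℕ.+ j) + x ^ (m ℕ.+ (i ∸ j))       ≈⟨ +-congˡ (^-homo-* x m (i ∸ j)) ⟩
    x ^ (i ℕ.+ j) + x ^ m * x ^ (i ∸ j)       ∎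
    where
    exponent : i ℕ.+ (m ∸ j) ≡ m ℕ.+ (i ∸ j)
    exponent = ≡.trans (≡.sym (ℕ.+-∸-assoc i j≤m))
                 (≡.trans (≡.cong (_∸ j) (ℕ.+-comm i m)) (ℕ.+-∸-assoc m j≤i))

-- 𝔽₂[x] as a commutative ring

module PolynomialRing where

  -- A record rather than Defs' function type, so that f and g can be inferred.
  infix 4 _≈_
  record _≈_ (f g : Poly) : Set where
    constructor mk≈
    field coeff-≈ : ∀ i → coeff f i ≡ coeff g i
  open _≈_ public

  ≈-refl : ∀ {f} → f ≈ f
  ≈-refl = mk≈ λ _ → refl

  ≈-sym : ∀ {f g} → f ≈ g → g ≈ f
  ≈-sym f≈g = mk≈ λ i → ≡.sym (coeff-≈ f≈g i)

  ≈-trans : ∀ {f g h} → f ≈ g → g ≈ h → f ≈ h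
  ≈-trans f≈g g≈h = mk≈ λ i → ≡.trans (coeff-≈ f≈g i) (coeff-≈ g≈h i)

  ≈-setoid : Setoid 0ℓ 0ℓ
  ≈-setoid = record
    { Carrier = Poly ; _≈_ = _≈_
    ; isEquivalence = record { refl = ≈-refl ; sym = ≈-sym ; trans = ≈-trans } }

  module ≈-Reasoning = Relation.Binary.Reasoning.Setoid ≈-setoid

  ∷-cong : ∀ {a b f g} → a ≡ b → f ≈ g → a ∷ f ≈ b ∷ g
  ∷-cong a≡b f≈g = mk≈ λ { zero → a≡b ; (suc i) → coeff-≈ f≈g i }

  ∷-injectiveʳ : ∀ {a b f g} → a ∷ f ≈ b ∷ g → f ≈ g
  ∷-injectiveʳ e = mk≈ λ i → coeff-≈ e (suc i)

  [false]≈[] : false ∷ [] ≈ []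
  [false]≈[] = mk≈ λ { zero → refl ; (suc i) → refl }

  coeff-+ : ∀ f g i → coeff (f +ₚ g) i ≡ coeff f i xor coeff g i
  coeff-+ []      g       i       = refl
  coeff-+ (a ∷ f) []      i       = ≡.sym (xor-identityʳ _)
  coeff-+ (a ∷ f) (b ∷ g) zero    = refl
  coeff-+ (a ∷ f) (b ∷ g) (suc i) = coeff-+ f g i

  +-cong : ∀ {f f′ g g′} → f ≈ f′ → g ≈ g′ → f +ₚ g ≈ f′ +ₚ g′
  +-cong {f} {f′} {g} {g′} f≈f′ g≈g′ = mk≈ λ i →
    ≡.trans (coeff-+ f g i)
      (≡.trans (cong₂ _xor_ (coeff-≈ f≈f′ i) (coeff-≈ g≈g′ i)) (≡.sym (coeff-+ f′ g′ i)))

  +-assoc : ∀ f g h → (f +ₚ g) +ₚ h ≈ f +ₚ (g +ₚ h)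
  +-assoc f g h = mk≈ λ i → begin
    coeff ((f +ₚ g) +ₚ h) i                ≡⟨ coeff-+ (f +ₚ g) h i ⟩
    coeff (f +ₚ g) i xor coeff h i         ≡⟨ cong (_xor coeff h i) (coeff-+ f g i) ⟩
    (coeff f i xor coeff g i) xor coeff h i ≡⟨ xor-assoc (coeff f i) _ _ ⟩
    coeff f i xor (coeff g i xor coeff h i) ≡⟨ cong (coeff f i xor_) (coeff-+ g h i) ⟨
    coeff f i xor coeff (g +ₚ h) i         ≡⟨ coeff-+ f (g +ₚ h) i ⟨
    coeff (f +ₚ (g +ₚ h)) i                ∎
    where open ≡.≡-Reasoning

  +-comm : ∀ f g → f +ₚ g ≈ g +ₚ f
  +-comm f g = mk≈ λ i →
    ≡.trans (coeff-+ f g i) (≡.trans (xor-comm (coeff f i) _) (≡.sym (coeff-+ g f i)))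

  +-identityʳ : ∀ f → f +ₚ [] ≈ f
  +-identityʳ f = mk≈ λ i → ≡.trans (coeff-+ f [] i) (xor-identityʳ _)

  +-self : ∀ f → f +ₚ f ≈ []
  +-self f = mk≈ λ i → ≡.trans (coeff-+ f f i) (xor-same (coeff f i))

  +-commutativeSemigroup : CommutativeSemigroup 0ℓ 0ℓ
  +-commutativeSemigroup = record
    { _≈_ = _≈_ ; _∙_ = _+ₚ_
    ; isCommutativeSemigroup = record
      { isSemigroup = record
        { isMagma = record { isEquivalence = Setoid.isEquivalence ≈-setoid ; ∙-cong = +-cong }
        ; assoc = +-assoc }
      ; comm = +-comm } }

  open Algebra.Properties.CommutativeSemigroup +-commutativeSemigroup
    using (interchange; x∙yz≈y∙xz) public

  scaleₚ-cong : ∀ a {g g′} → g ≈ g′ → scaleₚ a g ≈ scaleₚ a g′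
  scaleₚ-cong false _    = ≈-refl
  scaleₚ-cong true  g≈g′ = g≈g′

  scaleₚ-xor : ∀ a b h → scaleₚ (a xor b) h ≈ scaleₚ a h +ₚ scaleₚ b h
  scaleₚ-xor false b     h = ≈-refl
  scaleₚ-xor true  false h = ≈-sym (+-identityʳ h)
  scaleₚ-xor true  true  h = ≈-sym (+-self h)

  scaleₚ-* : ∀ a g h → scaleₚ a g *ₚ h ≈ scaleₚ a (g *ₚ h)
  scaleₚ-* false g h = ≈-refl
  scaleₚ-* true  g h = ≈-refl

  *-congʳ : ∀ f {g g′} → g ≈ g′ → f *ₚ g ≈ f *ₚ g′
  *-congʳ []      g≈g′ = ≈-refl
  *-congʳ (a ∷ f) g≈g′ = +-cong (scaleₚ-cong a g≈g′) (∷-cong refl (*-congʳ f g≈g′))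

  *-zeroʳ : ∀ f → f *ₚ [] ≈ []
  *-zeroʳ []          = ≈-refl
  *-zeroʳ (false ∷ f) = ≈-trans (∷-cong refl (*-zeroʳ f)) [false]≈[]
  *-zeroʳ (true  ∷ f) = ≈-trans (∷-cong refl (*-zeroʳ f)) [false]≈[]

  *-∷ʳ : ∀ g a f → g *ₚ (a ∷ f) ≈ scaleₚ a g +ₚ (false ∷ (g *ₚ f))
  *-∷ʳ []      false f = ≈-sym [false]≈[]
  *-∷ʳ []      true  f = ≈-sym [false]≈[]
  *-∷ʳ (b ∷ g) a     f = ≈-trans (+-cong (≈-refl {scaleₚ b (a ∷ f)}) (∷-cong refl (*-∷ʳ g a f))) (swap b a)
    where
    swap : ∀ b a → scaleₚ b (a ∷ f) +ₚ (false ∷ (scaleₚ a g +ₚ (false ∷ (g *ₚ f))))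
                 ≈ scaleₚ a (b ∷ g) +ₚ (false ∷ (scaleₚ b f +ₚ (false ∷ (g *ₚ f))))
    swap false false = ≈-refl
    swap false true  = ≈-refl
    swap true  false = ≈-refl
    swap true  true  = ∷-cong refl (x∙yz≈y∙xz f g _)

  *-comm : ∀ f g → f *ₚ g ≈ g *ₚ f
  *-comm []      g = ≈-sym (*-zeroʳ g)
  *-comm (a ∷ f) g =
    ≈-trans (+-cong (≈-refl {scaleₚ a g}) (∷-cong refl (*-comm f g))) (≈-sym (*-∷ʳ g a f))

  *-congˡ : ∀ {f f′} g → f ≈ f′ → f *ₚ g ≈ f′ *ₚ g
  *-congˡ {f} {f′} g f≈f′ = ≈-trans (*-comm f g) (≈-trans (*-congʳ g f≈f′) (*-comm g f′))

  *-cong : ∀ {f f′ g g′} → f ≈ f′ → g ≈ g′ → f *ₚ g ≈ f′ *ₚ g′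
  *-cong {f′ = f′} {g} f≈f′ g≈g′ = ≈-trans (*-congˡ g f≈f′) (*-congʳ f′ g≈g′)

  distribʳ : ∀ h f g → (f +ₚ g) *ₚ h ≈ f *ₚ h +ₚ g *ₚ h
  distribʳ h []      g       = ≈-refl
  distribʳ h (a ∷ f) []      = ≈-sym (+-identityʳ _)
  distribʳ h (a ∷ f) (b ∷ g) =
    ≈-trans (+-cong (scaleₚ-xor a b h) (∷-cong refl (distribʳ h f g)))
            (interchange (scaleₚ a h) (scaleₚ b h) (false ∷ (f *ₚ h)) (false ∷ (g *ₚ h)))

  distribˡ : ∀ h f g → h *ₚ (f +ₚ g) ≈ h *ₚ f +ₚ h *ₚ g
  distribˡ h f g = begin
    h *ₚ (f +ₚ g)         ≈⟨ *-comm h (f +ₚ g) ⟩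
    (f +ₚ g) *ₚ h         ≈⟨ distribʳ h f g ⟩
    f *ₚ h +ₚ g *ₚ h      ≈⟨ +-cong (*-comm f h) (*-comm g h) ⟩
    h *ₚ f +ₚ h *ₚ g      ∎
    where open ≈-Reasoning

  *-assoc : ∀ f g h → (f *ₚ g) *ₚ h ≈ f *ₚ (g *ₚ h)
  *-assoc []      g h = ≈-refl
  *-assoc (a ∷ f) g h =
    ≈-trans (distribʳ h (scaleₚ a g) (false ∷ (f *ₚ g)))
            (+-cong (scaleₚ-* a g h) (∷-cong refl (*-assoc f g h)))

  *-identityˡ : ∀ f → oneₚ *ₚ f ≈ f
  *-identityˡ f = ≈-trans (+-cong (≈-refl {f}) [false]≈[]) (+-identityʳ f)

  *-identityʳ : ∀ f → f *ₚ oneₚ ≈ f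
  *-identityʳ f = ≈-trans (*-comm f oneₚ) (*-identityˡ f)

  𝔽₂[x] : CommutativeRing 0ℓ 0ℓ
  𝔽₂[x] = record
    { Carrier = Poly ; _≈_ = _≈_ ; _+_ = _+ₚ_ ; _*_ = _*ₚ_ ; -_ = id ; 0# = [] ; 1# = oneₚ
    ; isCommutativeRing = record
      { isRing = record
        { +-isAbelianGroup = record
          { isGroup = record
            { isMonoid = record
              { isSemigroup = CommutativeSemigroup.isSemigroup +-commutativeSemigroup
              ; identity = (λ _ → ≈-refl) , +-identityʳ }
            ; inverse = +-self , +-self
            ; ⁻¹-cong = id }
          ; comm = +-comm }
        ; *-cong = *-cong
        ; *-assoc = *-assoc
        ; *-identity = *-identityˡ , *-identityʳ
        ; distrib = distribˡ , distribʳ }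
      ; *-comm = *-comm } }

open PolynomialRing
open import Algebra.Properties.Semiring.Exp (CommutativeRing.semiring 𝔽₂[x])
  using (_^_; ^-homo-*; ^-assocʳ; ^-congˡ; ^-congʳ)
open CommutativeRing 𝔽₂[x] using (+-congˡ; +-congʳ) renaming (reflexive to ≈-reflexive)
open PowerTheory 𝔽₂[x]
open IdealTheory 𝔽₂[x]

isZero : Poly → Bool
isZero []      = true
isZero (a ∷ f) = not a ∧ isZero f

isZero⇒≈[] : ∀ f → T (isZero f) → f ≈ []
isZero⇒≈[] []          _      = ≈-refl
isZero⇒≈[] (false ∷ f) f≈0 = ≈-trans (∷-cong refl (isZero⇒≈[] f f≈0)) [false]≈[]

≈-compute : ∀ f g → T (isZero (f +ₚ g)) → f ≈ g
≈-compute f g f+g≈0 = begin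
  f                ≈⟨ +-identityʳ f ⟨
  f +ₚ []          ≈⟨ +-congˡ (+-self g) ⟨
  f +ₚ (g +ₚ g)    ≈⟨ +-assoc f g g ⟨
  (f +ₚ g) +ₚ g    ≈⟨ +-cong (isZero⇒≈[] (f +ₚ g) f+g≈0) (≈-refl {g}) ⟩
  g                ∎
  where open ≈-Reasoning

-- Composition of polynomials

-- Horner evaluation f(p), written so that compX^ k f is definitionally f ∘ₚ X^ k.
infixl 8 _∘ₚ_

_∘ₚ_ : Poly → Poly → Poly
f ∘ₚ p = foldr (λ a acc → (a ∷ []) +ₚ (p *ₚ acc)) [] f

module _ where
  open ≈-Reasoning

  constant-∘ₚ : ∀ a p → (a ∷ []) ∘ₚ p ≈ a ∷ []
  constant-∘ₚ a p = ≈-trans (+-congˡ (*-zeroʳ p)) (+-identityʳ (a ∷ []))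

  ∘ₚ-zero : ∀ {f} p → f ≈ [] → f ∘ₚ p ≈ []
  ∘ₚ-zero {[]}       p _   = ≈-refl
  ∘ₚ-zero {false ∷ f} p f≈[] = begin
    (false ∷ []) +ₚ p *ₚ (f ∘ₚ p)
      ≈⟨ +-cong [false]≈[] (*-congʳ p (∘ₚ-zero {f} p (mk≈ λ i → coeff-≈ f≈[] (suc i)))) ⟩
    p *ₚ []                       ≈⟨ *-zeroʳ p ⟩
    []                            ∎
  ∘ₚ-zero {true ∷ f}  p f≈[] with coeff-≈ f≈[] 0
  ... | ()

  ∘ₚ-congˡ : ∀ {f g} p → f ≈ g → f ∘ₚ p ≈ g ∘ₚ p
  ∘ₚ-congˡ {[]}    p f≈g = ≈-sym (∘ₚ-zero p (≈-sym f≈g))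
  ∘ₚ-congˡ {a ∷ f} {[]}    p f≈g = ∘ₚ-zero p f≈g
  ∘ₚ-congˡ {a ∷ f} {b ∷ g} p f≈g with coeff-≈ f≈g 0
  ... | refl = +-congˡ (*-congʳ p (∘ₚ-congˡ p (∷-injectiveʳ f≈g)))

  ∘ₚ-congʳ : ∀ f {p q} → p ≈ q → f ∘ₚ p ≈ f ∘ₚ q
  ∘ₚ-congʳ []      _   = ≈-refl
  ∘ₚ-congʳ (a ∷ f) p≈q = +-congˡ (*-cong p≈q (∘ₚ-congʳ f p≈q))

  +-∘ₚ : ∀ f g p → (f +ₚ g) ∘ₚ p ≈ f ∘ₚ p +ₚ g ∘ₚ p
  +-∘ₚ []      g       p = ≈-refl
  +-∘ₚ (a ∷ f) []      p = ≈-sym (+-identityʳ _)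
  +-∘ₚ (a ∷ f) (b ∷ g) p = begin
    ((a xor b) ∷ []) +ₚ p *ₚ ((f +ₚ g) ∘ₚ p)
      ≈⟨ +-congˡ (*-congʳ p (+-∘ₚ f g p)) ⟩
    ((a ∷ []) +ₚ (b ∷ [])) +ₚ p *ₚ (f ∘ₚ p +ₚ g ∘ₚ p)
      ≈⟨ +-congˡ (distribˡ p _ _) ⟩
    ((a ∷ []) +ₚ (b ∷ [])) +ₚ (p *ₚ (f ∘ₚ p) +ₚ p *ₚ (g ∘ₚ p))
      ≈⟨ interchange (a ∷ []) (b ∷ []) (p *ₚ (f ∘ₚ p)) (p *ₚ (g ∘ₚ p)) ⟩
    (a ∷ f) ∘ₚ p +ₚ (b ∷ g) ∘ₚ p ∎

  *-∘ₚ : ∀ f g p → (f *ₚ g) ∘ₚ p ≈ f ∘ₚ p *ₚ g ∘ₚ p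
  *-∘ₚ []      g p = ≈-refl
  *-∘ₚ (a ∷ f) g p = begin
    (scaleₚ a g +ₚ (false ∷ (f *ₚ g))) ∘ₚ p
      ≈⟨ +-∘ₚ (scaleₚ a g) (false ∷ (f *ₚ g)) p ⟩
    scaleₚ a g ∘ₚ p +ₚ ((false ∷ []) +ₚ p *ₚ ((f *ₚ g) ∘ₚ p))
      ≈⟨ +-cong (scale-∘ₚ a) (+-cong [false]≈[] (*-congʳ p (*-∘ₚ f g p))) ⟩
    (a ∷ []) *ₚ g ∘ₚ p +ₚ p *ₚ (f ∘ₚ p *ₚ g ∘ₚ p)
      ≈⟨ +-congˡ (*-assoc p (f ∘ₚ p) (g ∘ₚ p)) ⟨
    (a ∷ []) *ₚ g ∘ₚ p +ₚ p *ₚ (f ∘ₚ p) *ₚ g ∘ₚ p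
      ≈⟨ distribʳ (g ∘ₚ p) (a ∷ []) (p *ₚ (f ∘ₚ p)) ⟨
    (a ∷ f) ∘ₚ p *ₚ g ∘ₚ p ∎
    where
    scale-∘ₚ : ∀ a → scaleₚ a g ∘ₚ p ≈ (a ∷ []) *ₚ g ∘ₚ p
    scale-∘ₚ false = ≈-sym [false]≈[]
    scale-∘ₚ true  = ≈-sym (*-identityˡ (g ∘ₚ p))

  X^-∘ₚ : ∀ n p → X^ n ∘ₚ p ≈ p ^ n
  X^-∘ₚ zero    p = constant-∘ₚ true p
  X^-∘ₚ (suc n) p = +-cong [false]≈[] (*-congʳ p (X^-∘ₚ n p))

  ∘ₚ-assoc : ∀ f q p → (f ∘ₚ q) ∘ₚ p ≈ f ∘ₚ (q ∘ₚ p)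
  ∘ₚ-assoc []      q p = ≈-refl
  ∘ₚ-assoc (a ∷ f) q p = begin
    ((a ∷ []) +ₚ q *ₚ (f ∘ₚ q)) ∘ₚ p        ≈⟨ +-∘ₚ (a ∷ []) (q *ₚ (f ∘ₚ q)) p ⟩
    (a ∷ []) ∘ₚ p +ₚ (q *ₚ (f ∘ₚ q)) ∘ₚ p   ≈⟨ +-cong (constant-∘ₚ a p) (*-∘ₚ q (f ∘ₚ q) p) ⟩
    (a ∷ []) +ₚ q ∘ₚ p *ₚ (f ∘ₚ q) ∘ₚ p     ≈⟨ +-congˡ (*-congʳ (q ∘ₚ p) (∘ₚ-assoc f q p)) ⟩
    (a ∷ []) +ₚ q ∘ₚ p *ₚ f ∘ₚ (q ∘ₚ p)     ∎

X^+X^-∘ₚ : ∀ a b p → (X^ a +ₚ X^ b) ∘ₚ p ≈ p ^ a +ₚ p ^ b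
X^+X^-∘ₚ a b p = ≈-trans (+-∘ₚ (X^ a) (X^ b) p) (+-cong (X^-∘ₚ a p) (X^-∘ₚ b p))

X : Poly
X = X^ 1

∘ₚ-identityʳ : ∀ f → f ∘ₚ X ≈ f
∘ₚ-identityʳ []      = ≈-refl
∘ₚ-identityʳ (a ∷ f) =
  ≈-trans (+-congˡ {a ∷ []} (*-congʳ X (∘ₚ-identityʳ f)))
          (∷-cong (xor-identityʳ a) (*-identityˡ f))

X^≈X^ : ∀ n → X^ n ≈ X ^ n
X^≈X^ n = ≈-trans (≈-sym (∘ₚ-identityʳ (X^ n))) (X^-∘ₚ n X)

X^-^ : ∀ g i → X^ g ^ i ≈ X^ (g ℕ.* i)
X^-^ g i = begin
  X^ g ^ i         ≈⟨ ^-congˡ i (X^≈X^ g) ⟩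
  (X ^ g) ^ i      ≈⟨ ^-assocʳ X g i ⟩
  X ^ (g ℕ.* i)    ≈⟨ X^≈X^ (g ℕ.* i) ⟨
  X^ (g ℕ.* i)     ∎
  where open ≈-Reasoning

X^∘ₚX^ : ∀ i g → X^ i ∘ₚ X^ g ≈ X^ (g ℕ.* i)
X^∘ₚX^ i g = ≈-trans (X^-∘ₚ i (X^ g)) (X^-^ g i)

Φ₃ : Poly
Φ₃ = true ∷ true ∷ true ∷ []

Φ₉ : Poly
Φ₉ = Φ₃ ∘ₚ X^ 3

-- x^i c(x) with each x^(i + m - j) reduced to x^(i - j), as allowed when x^m = 1 and j ≤ i.
cShifted : ℕ → List ℕ → Poly
cShifted i = foldr (λ j acc → acc +ₚ (X^ (i ℕ.+ j) +ₚ X^ (i ∸ j))) (X^ i)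

X³+1≈[1+X]Φ₃ : X^ 3 +ₚ oneₚ ≈ (oneₚ +ₚ X) *ₚ Φ₃
X³+1≈[1+X]Φ₃ = ≈-compute _ _ _

Φ₃∘ₚX²≈Φ₃² : Φ₃ ∘ₚ X^ 2 ≈ Φ₃ *ₚ Φ₃
Φ₃∘ₚX²≈Φ₃² = ≈-compute _ _ _

Φ₃∘ₚ1≈1 : Φ₃ ∘ₚ oneₚ ≈ oneₚ
Φ₃∘ₚ1≈1 = ≈-compute _ _ _

Φ₃³Φ₉ : Poly
Φ₃³Φ₉ = Φ₃ *ₚ (Φ₃ *ₚ (Φ₃ *ₚ Φ₉))

cShifted≈Φ₃³Φ₉ : cShifted 6 (1 ∷ 2 ∷ 5 ∷ 6 ∷ []) ≈ Φ₃³Φ₉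
cShifted≈Φ₃³Φ₉ = ≈-compute _ _ _

[1+q]Φ₃[q]≈q³+1 : ∀ q → (oneₚ +ₚ X) ∘ₚ q *ₚ Φ₃ ∘ₚ q ≈ q ^ 3 +ₚ oneₚ
[1+q]Φ₃[q]≈q³+1 q = begin
  (oneₚ +ₚ X) ∘ₚ q *ₚ Φ₃ ∘ₚ q    ≈⟨ *-∘ₚ (oneₚ +ₚ X) Φ₃ q ⟨
  ((oneₚ +ₚ X) *ₚ Φ₃) ∘ₚ q       ≈⟨ ∘ₚ-congˡ q X³+1≈[1+X]Φ₃ ⟨
  (X^ 3 +ₚ oneₚ) ∘ₚ q            ≈⟨ +-∘ₚ (X^ 3) oneₚ q ⟩
  X^ 3 ∘ₚ q +ₚ oneₚ ∘ₚ q         ≈⟨ +-cong (X^-∘ₚ 3 q) (constant-∘ₚ true q) ⟩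
  q ^ 3 +ₚ oneₚ                  ∎
  where open ≈-Reasoning

-- Arithmetic modulo an ideal of 𝔽₂[x]

¬3∣n⇒n%3≡1⊎n%3≡2 : ∀ {n} → ¬ 3 ∣ n → n % 3 ≡ 1 ⊎ n % 3 ≡ 2
¬3∣n⇒n%3≡1⊎n%3≡2 {n} ¬3∣n with n % 3 in n%3≡r | m%n<n n 3
... | 0                 | _                      = ⊥-elim (¬3∣n (m%n≡0⇒n∣m n 3 n%3≡r))
... | 1                 | _                      = inj₁ refl
... | 2                 | _                      = inj₂ refl
... | suc (suc (suc _)) | s≤s (s≤s (s≤s ()))

module ModuloIdeal (I : Ideal) where
  private module Q = CommutativeRing (quotientRing I)
  open Ideal I using (∈-resp; *-closed)
  open import Relation.Binary.Reasoning.Setoid Q.setoid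

  ^-cong-mod : ∀ n {p q} → p ≋ q mod I → p ^ n ≋ q ^ n mod I
  ^-cong-mod zero    _   = Q.refl
  ^-cong-mod (suc n) p≋q = Q.*-cong p≋q (^-cong-mod n p≋q)

  ∘ₚ-cong-mod : ∀ f {p q} → p ≋ q mod I → f ∘ₚ p ≋ f ∘ₚ q mod I
  ∘ₚ-cong-mod []      _   = Q.refl
  ∘ₚ-cong-mod (a ∷ f) p≋q = Q.+-congˡ {a ∷ []} (Q.*-cong p≋q (∘ₚ-cong-mod f p≋q))

  x^m≋1∧m∣n⇒x^n≋1 : ∀ {p m n} → p ^ m ≋ oneₚ mod I → m ∣ n → p ^ n ≋ oneₚ mod I
  x^m≋1∧m∣n⇒x^n≋1 {p} {m} p^m≋1 (divides q refl) = begin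
    p ^ (q ℕ.* m)  ≈⟨ ≈⇒≋ I (^-congʳ p (ℕ.*-comm q m)) ⟩
    p ^ (m ℕ.* q)  ≈⟨ ≈⇒≋ I (^-assocʳ p m q) ⟨
    (p ^ m) ^ q    ≈⟨ ^-cong-mod q p^m≋1 ⟩
    oneₚ ^ q       ≈⟨ ≈⇒≋ I (1#^n≈1# q) ⟩
    oneₚ           ∎

  x^m≋1⇒x^n≋x^[n%m] : ∀ {p} m .{{_ : NonZero m}} → p ^ m ≋ oneₚ mod I → ∀ n → p ^ n ≋ p ^ (n % m) mod I
  x^m≋1⇒x^n≋x^[n%m] {p} m p^m≋1 n = begin
    p ^ n                          ≈⟨ ≈⇒≋ I (x^n≈x^[n%m]*[x^m]^[n/m] p m n) ⟩
    p ^ (n % m) *ₚ (p ^ m) ^ (n / m) ≈⟨ Q.*-congˡ {p ^ (n % m)} (^-cong-mod (n / m) p^m≋1) ⟩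
    p ^ (n % m) *ₚ oneₚ ^ (n / m)    ≈⟨ ≈⇒≋ I (≈-trans (*-congʳ (p ^ (n % m)) (1#^n≈1# (n / m))) (*-identityʳ _)) ⟩
    p ^ (n % m)                    ∎

  x^3≋1⇒x^n≋x⊎x^n≋x² : ∀ {p n} → p ^ 3 ≋ oneₚ mod I → ¬ 3 ∣ n → p ^ n ≋ p mod I ⊎ p ^ n ≋ p ^ 2 mod I
  x^3≋1⇒x^n≋x⊎x^n≋x² {p} {n} p³≋1 ¬3∣n with ¬3∣n⇒n%3≡1⊎n%3≡2 ¬3∣n
  ... | inj₁ n%3≡1 = inj₁ (Q.trans (x^m≋1⇒x^n≋x^[n%m] 3 p³≋1 n)
                            (Q.trans (Q.reflexive (≡.cong (p ^_) n%3≡1)) (≈⇒≋ I (*-identityʳ p))))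
  ... | inj₂ n%3≡2 = inj₂ (Q.trans (x^m≋1⇒x^n≋x^[n%m] 3 p³≋1 n) (Q.reflexive (≡.cong (p ^_) n%3≡2)))

  Φ₃-root⇒x³≋1 : ∀ q → Φ₃ ∘ₚ q ∈ I → q ^ 3 ≋ oneₚ mod I
  Φ₃-root⇒x³≋1 q Φ₃[q]∈I = mk≋ (∈-resp ([1+q]Φ₃[q]≈q³+1 q) (*-closed ((oneₚ +ₚ X) ∘ₚ q) Φ₃[q]∈I))

  Φ₃-root∧x^n≋1⇒1∈I : ∀ q {n} → Φ₃ ∘ₚ q ∈ I → q ^ n ≋ oneₚ mod I → ¬ 3 ∣ n → oneₚ ∈ I
  Φ₃-root∧x^n≋1⇒1∈I q Φ₃[q]∈I q^n≋1 ¬3∣n = ≋0⇒∈ I (begin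
    oneₚ          ≈⟨ ≈⇒≋ I Φ₃∘ₚ1≈1 ⟨
    Φ₃ ∘ₚ oneₚ    ≈⟨ ∘ₚ-cong-mod Φ₃ q≋1 ⟨
    Φ₃ ∘ₚ q       ≈⟨ ∈⇒≋0 I Φ₃[q]∈I ⟩
    []            ∎)
    where
    q³≋1 = Φ₃-root⇒x³≋1 q Φ₃[q]∈I
    q≋1 : q ≋ oneₚ mod I
    q≋1 with x^3≋1⇒x^n≋x⊎x^n≋x² q³≋1 ¬3∣n
    ... | inj₁ q^n≋q  = Q.trans (Q.sym q^n≋q) q^n≋1
    ... | inj₂ q^n≋q² = begin
      q                 ≈⟨ ≈⇒≋ I (*-identityʳ q) ⟨
      q *ₚ oneₚ         ≈⟨ Q.*-congˡ {q} (Q.trans (Q.sym q^n≋q²) q^n≋1) ⟨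
      q *ₚ q ^ 2        ≈⟨ q³≋1 ⟩
      oneₚ              ∎

  Φ₃-root⇒Φ₃-root-^ : ∀ z {n} → Φ₃ ∘ₚ z ∈ I → ¬ 3 ∣ n → Φ₃ ∘ₚ (z ^ n) ∈ I
  Φ₃-root⇒Φ₃-root-^ z {n} Φ₃[z]∈I ¬3∣n
    with x^3≋1⇒x^n≋x⊎x^n≋x² (Φ₃-root⇒x³≋1 z Φ₃[z]∈I) ¬3∣n
  ... | inj₁ z^n≋z  = ≋0⇒∈ I (Q.trans (∘ₚ-cong-mod Φ₃ z^n≋z) (∈⇒≋0 I Φ₃[z]∈I))
  ... | inj₂ z^n≋z² = ≋0⇒∈ I (begin
    Φ₃ ∘ₚ (z ^ n)             ≈⟨ ∘ₚ-cong-mod Φ₃ z^n≋z² ⟩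
    Φ₃ ∘ₚ (z ^ 2)             ≈⟨ ∘ₚ-cong-mod Φ₃ (≈⇒≋ I (X^-∘ₚ 2 z)) ⟨
    Φ₃ ∘ₚ (X^ 2 ∘ₚ z)         ≈⟨ ≈⇒≋ I (∘ₚ-assoc Φ₃ (X^ 2) z) ⟨
    (Φ₃ ∘ₚ X^ 2) ∘ₚ z         ≈⟨ ≈⇒≋ I (≈-trans (∘ₚ-congˡ z Φ₃∘ₚX²≈Φ₃²) (*-∘ₚ Φ₃ Φ₃ z)) ⟩
    Φ₃ ∘ₚ z *ₚ Φ₃ ∘ₚ z         ≈⟨ ∈⇒≋0 I (*-closed (Φ₃ ∘ₚ z) Φ₃[z]∈I) ⟩
    []                        ∎)

  x^i*c[x]≋cShifted : ∀ {p m i} C → p ^ m ≋ oneₚ mod I → All (_≤ i) C → i ≤ m →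
                      p ^ i *ₚ cPoly m C ∘ₚ p ≋ cShifted i C ∘ₚ p mod I
  x^i*c[x]≋cShifted {p} {m} {i} [] _ _ _ =
    ≈⇒≋ I (≈-trans (*-congʳ (p ^ i) (constant-∘ₚ true p)) (≈-trans (*-identityʳ (p ^ i)) (≈-sym (X^-∘ₚ i p))))
  x^i*c[x]≋cShifted {p} {m} {i} (j ∷ C) p^m≋1 (j≤i ∷ C≤i) i≤m = begin
    p ^ i *ₚ (c +ₚ (X^ j +ₚ X^ (m ∸ j))) ∘ₚ p
      ≈⟨ ≈⇒≋ I (*-congʳ (p ^ i)
                 (≈-trans (+-∘ₚ c (X^ j +ₚ X^ (m ∸ j)) p) (+-congˡ (X^+X^-∘ₚ j (m ∸ j) p)))) ⟩
    p ^ i *ₚ (c ∘ₚ p +ₚ (p ^ j +ₚ p ^ (m ∸ j)))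
      ≈⟨ ≈⇒≋ I (≈-trans (distribˡ (p ^ i) (c ∘ₚ p) _)
                 (+-congˡ (x^i*[x^j+x^[m∸j]]≈x^[i+j]+x^m*x^[i∸j] p m i j j≤i (ℕ.≤-trans j≤i i≤m)))) ⟩
    p ^ i *ₚ c ∘ₚ p +ₚ (p ^ (i ℕ.+ j) +ₚ p ^ m *ₚ p ^ (i ∸ j))
      ≈⟨ Q.+-cong (x^i*c[x]≋cShifted C p^m≋1 C≤i i≤m) (Q.+-congˡ {p ^ (i ℕ.+ j)} (Q.*-congʳ p^m≋1)) ⟩
    cShifted i C ∘ₚ p +ₚ (p ^ (i ℕ.+ j) +ₚ oneₚ *ₚ p ^ (i ∸ j))
      ≈⟨ ≈⇒≋ I (≈-sym (≈-trans (+-∘ₚ (cShifted i C) _ p)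
                 (+-congˡ (≈-trans (X^+X^-∘ₚ (i ℕ.+ j) (i ∸ j) p)
                                   (+-congˡ {p ^ (i ℕ.+ j)} (≈-sym (*-identityˡ _))))))) ⟩
    cShifted i (j ∷ C) ∘ₚ p
      ∎
    where c = cPoly m C

  c[p]∈I⇔Φ₃³Φ₉[p]∈I : ∀ p {m} → p ^ m ≋ oneₚ mod I → 6 ≤ m →
                       cPoly m (1 ∷ 2 ∷ 5 ∷ 6 ∷ []) ∘ₚ p ∈ I ⇔ Φ₃³Φ₉ ∘ₚ p ∈ I
  c[p]∈I⇔Φ₃³Φ₉[p]∈I p {m} p^m≋1 6≤m = mk⇔
    (λ c[p]∈I → ≋0⇒∈ I (begin
      Φ₃³Φ₉ ∘ₚ p                 ≈⟨ p⁶c[p]≋Φ₃³Φ₉[p] ⟨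
      p ^ 6 *ₚ c ∘ₚ p            ≈⟨ Q.*-congˡ {p ^ 6} (∈⇒≋0 I c[p]∈I) ⟩
      p ^ 6 *ₚ []                ≈⟨ ≈⇒≋ I (*-zeroʳ (p ^ 6)) ⟩
      []                         ∎))
    (λ Φ₃³Φ₉[p]∈I → ≋0⇒∈ I (begin
      c ∘ₚ p                         ≈⟨ ≈⇒≋ I (*-identityˡ (c ∘ₚ p)) ⟨
      oneₚ *ₚ c ∘ₚ p                 ≈⟨ Q.*-congʳ p^m≋1 ⟨
      p ^ m *ₚ c ∘ₚ p
        ≈⟨ ≈⇒≋ I (≈-trans (*-congˡ (c ∘ₚ p) p^m≈p^[m∸6]p⁶) (*-assoc (p ^ (m ∸ 6)) (p ^ 6) (c ∘ₚ p))) ⟩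
      p ^ (m ∸ 6) *ₚ (p ^ 6 *ₚ c ∘ₚ p) ≈⟨ Q.*-congˡ {p ^ (m ∸ 6)} p⁶c[p]≋Φ₃³Φ₉[p] ⟩
      p ^ (m ∸ 6) *ₚ Φ₃³Φ₉ ∘ₚ p      ≈⟨ Q.*-congˡ {p ^ (m ∸ 6)} (∈⇒≋0 I Φ₃³Φ₉[p]∈I) ⟩
      p ^ (m ∸ 6) *ₚ []              ≈⟨ ≈⇒≋ I (*-zeroʳ (p ^ (m ∸ 6))) ⟩
      []                             ∎))
    where
    c = cPoly m (1 ∷ 2 ∷ 5 ∷ 6 ∷ [])
    p⁶c[p]≋Φ₃³Φ₉[p] : p ^ 6 *ₚ c ∘ₚ p ≋ Φ₃³Φ₉ ∘ₚ p mod I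
    p⁶c[p]≋Φ₃³Φ₉[p] =
      Q.trans (x^i*c[x]≋cShifted (1 ∷ 2 ∷ 5 ∷ 6 ∷ []) p^m≋1 (from-yes (all? (ℕ._≤? 6) (1 ∷ 2 ∷ 5 ∷ 6 ∷ []))) 6≤m)
              (≈⇒≋ I (∘ₚ-congˡ p cShifted≈Φ₃³Φ₉))
    p^m≈p^[m∸6]p⁶ : p ^ m ≈ p ^ (m ∸ 6) *ₚ p ^ 6
    p^m≈p^[m∸6]p⁶ = ≈-trans (^-congʳ p (≡.sym (ℕ.m∸n+n≡m 6≤m))) (^-homo-* p (m ∸ 6) 6)

  X^a^n≋1 : ∀ {m} a n → X^ m ≋ oneₚ mod I → m ∣ a ℕ.* n → X^ a ^ n ≋ oneₚ mod I
  X^a^n≋1 {m} a n xᵐ≋1 m∣an = Q.trans (≈⇒≋ I (≈-trans (X^-^ a n) (X^≈X^ (a ℕ.* n))))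
    (x^m≋1∧m∣n⇒x^n≋1 {X} {m} (Q.trans (≈⇒≋ I (≈-sym (X^≈X^ m))) xᵐ≋1) m∣an)

Φ₃∘ₚ-invertible : ∀ I q {n} → q ^ n ≋ oneₚ mod I → ¬ 3 ∣ n → oneₚ ∈ adjoin I (Φ₃ ∘ₚ q)
Φ₃∘ₚ-invertible I q q^n≋1 ¬3∣n =
  ModuloIdeal.Φ₃-root∧x^n≋1⇒1∈I (adjoin I (Φ₃ ∘ₚ q)) q
    (a∈adjoin I (Φ₃ ∘ₚ q)) (≋-adjoin I (Φ₃ ∘ₚ q) q^n≋1) ¬3∣n

Φ₃³Φ₉-root⇒1∈I : ∀ I q {n} → q ^ n ≋ oneₚ mod I → ¬ 3 ∣ n → Φ₃³Φ₉ ∘ₚ q ∈ I → oneₚ ∈ I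
Φ₃³Φ₉-root⇒1∈I I q {n} q^n≋1 ¬3∣n Φ₃³Φ₉[q]∈I =
  invertible-cancel I b (Φ₃∘ₚ-invertible I (q ^ 3) q³ⁿ≋1 ¬3∣n) (∈-resp (≈-sym (*-identityʳ b))
    (invertible-cancel I a a-invertible (invertible-cancel I a a-invertible (invertible-cancel I a a-invertible
      (∈-resp factorisation Φ₃³Φ₉[q]∈I)))))
  where
  open Ideal I using (∈-resp)
  a = Φ₃ ∘ₚ q
  b = Φ₃ ∘ₚ (q ^ 3)
  a-invertible = Φ₃∘ₚ-invertible I q q^n≋1 ¬3∣n
  q³ⁿ≋1 : (q ^ 3) ^ n ≋ oneₚ mod I
  q³ⁿ≋1 = ≋-trans I (≈⇒≋ I (^-assocʳ q 3 n))
            (ModuloIdeal.x^m≋1∧m∣n⇒x^n≋1 I {q} {n} q^n≋1 (n∣m*n 3))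
  factorisation : Φ₃³Φ₉ ∘ₚ q ≈ a *ₚ (a *ₚ (a *ₚ b))
  factorisation = begin
    Φ₃³Φ₉ ∘ₚ q                                  ≈⟨ *-∘ₚ Φ₃ (Φ₃ *ₚ (Φ₃ *ₚ Φ₉)) q ⟩
    a *ₚ (Φ₃ *ₚ (Φ₃ *ₚ Φ₉)) ∘ₚ q                ≈⟨ *-congʳ a (*-∘ₚ Φ₃ (Φ₃ *ₚ Φ₉) q) ⟩
    a *ₚ (a *ₚ (Φ₃ *ₚ Φ₉) ∘ₚ q)                 ≈⟨ *-congʳ a (*-congʳ a (*-∘ₚ Φ₃ Φ₉ q)) ⟩
    a *ₚ (a *ₚ (a *ₚ Φ₉ ∘ₚ q))                  ≈⟨ *-congʳ a (*-congʳ a (*-congʳ a Φ₉[q]≈b)) ⟩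
    a *ₚ (a *ₚ (a *ₚ b))                        ∎
    where
    open ≈-Reasoning
    Φ₉[q]≈b : Φ₉ ∘ₚ q ≈ b
    Φ₉[q]≈b = ≈-trans (∘ₚ-assoc Φ₃ (X^ 3) q) (∘ₚ-congʳ Φ₃ (X^-∘ₚ 3 q))

-- Principal ideals and degrees

multiples : Poly → Ideal
multiples d = record
  { Member   = λ f → ∃ λ q → q *ₚ d ≈ f
  ; ∈-resp   = λ { f≈g (q , qd≈f) → q , ≈-trans qd≈f f≈g }
  ; 0∈       = [] , ≈-refl
  ; +-closed = λ { (q , qd≈f) (r , rd≈g) → q +ₚ r , ≈-trans (distribʳ d q r) (+-cong qd≈f rd≈g) }
  ; *-closed = λ { h (q , qd≈f) → h *ₚ q , ≈-trans (*-assoc h q d) (*-congʳ h qd≈f) }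
  }

DegreeBelow : ℕ → Poly → Set
DegreeBelow n f = ∀ {i} → n ≤ i → coeff f i ≡ false

HasDegree : ℕ → Poly → Set
HasDegree n f = DegreeBelow (suc n) f × coeff f n ≡ true

HasDegree-resp : ∀ {n f g} → f ≈ g → HasDegree n f → HasDegree n g
HasDegree-resp f≈g (f<n , fₙ≡1) = (λ n<i → ≡.trans (≡.sym (coeff-≈ f≈g _)) (f<n n<i))
                                 , ≡.trans (≡.sym (coeff-≈ f≈g _)) fₙ≡1

DegreeBelow-X^ : ∀ {m n} → m ℕ.< n → DegreeBelow n (X^ m)
DegreeBelow-X^ {zero}  {suc n} _         {suc i} _               = refl
DegreeBelow-X^ {suc m} {suc n} (s≤s m<n) {suc i} (s≤s n≤i) = DegreeBelow-X^ m<n n≤i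

HasDegree-X^ : ∀ n → HasDegree n (X^ n)
HasDegree-X^ zero    = DegreeBelow-X^ (s≤s z≤n) , refl
HasDegree-X^ (suc n) = DegreeBelow-X^ (s≤s (ℕ.n<1+n n)) , proj₂ (HasDegree-X^ n)

DegreeBelow-+ : ∀ {n f g} → DegreeBelow n f → DegreeBelow n g → DegreeBelow n (f +ₚ g)
DegreeBelow-+ {f = f} {g} f<n g<n {i} n≤i = ≡.trans (coeff-+ f g i) (cong₂ _xor_ (f<n n≤i) (g<n n≤i))

HasDegree-+ : ∀ {n f g} → DegreeBelow n f → HasDegree n g → HasDegree n (f +ₚ g)
HasDegree-+ {n} {f} {g} f<n (g≤n , gₙ≡1) =
  DegreeBelow-+ {f = f} {g} (λ n<i → f<n (ℕ.<⇒≤ n<i)) g≤n ,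
  ≡.trans (coeff-+ f g n) (cong₂ _xor_ (f<n ℕ.≤-refl) gₙ≡1)

DegreeBelow-* : ∀ {a b} f {g} → DegreeBelow a f → DegreeBelow (suc b) g → DegreeBelow (a ℕ.+ b) (f *ₚ g)
DegreeBelow-* []      _   _   _ = refl
DegreeBelow-* {zero} (c ∷ f) {g} f<0 _ {i} _ = coeff-≈ (*-congˡ {c ∷ f} {[]} g (mk≈ λ j → f<0 {j} z≤n)) i
DegreeBelow-* {suc a} {b} (c ∷ f) {g} f<1+a g<1+b {suc i} (s≤s a+b≤i) =
  ≡.trans (coeff-+ (scaleₚ c g) (false ∷ (f *ₚ g)) (suc i))
          (cong₂ _xor_ (scaled c) (DegreeBelow-* f (λ a≤j → f<1+a (s≤s a≤j)) g<1+b a+b≤i))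
  where
  scaled : ∀ c → coeff (scaleₚ c g) (suc i) ≡ false
  scaled false = refl
  scaled true  = g<1+b (s≤s (ℕ.≤-trans (ℕ.m≤n+m b a) a+b≤i))

coeff-X^* : ∀ n f i → coeff (X^ n *ₚ f) (n ℕ.+ i) ≡ coeff f i
coeff-X^* zero    f i = coeff-≈ (*-identityˡ f) i
coeff-X^* (suc n) f i = coeff-X^* n f i

leading-term : ∀ q → q ≈ [] ⊎ ∃₂ λ a q′ → DegreeBelow a q′ × q ≈ q′ +ₚ X^ a
leading-term []      = inj₁ ≈-refl
leading-term (b ∷ q) with leading-term q
... | inj₂ (a , q′ , q′<a , q≈q′+xᵃ) =
  inj₂ (suc a , b ∷ q′ , (λ { (s≤s a≤i) → q′<a a≤i }) , ∷-cong (≡.sym (xor-identityʳ b)) q≈q′+xᵃ)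
... | inj₁ q≈[] with b
...   | false = inj₁ (≈-trans (∷-cong refl q≈[]) [false]≈[])
...   | true  = inj₂ (0 , [] , (λ _ → refl) , ∷-cong refl q≈[])

positive-degree⇒¬∣1 : ∀ {n d} → HasDegree n d → 1 ≤ n → ¬ (d ∣ₚ oneₚ)
positive-degree⇒¬∣1 {suc n} {d} (d<1+n , dₙ≡1) _ (q , qd≈1) with leading-term q
... | inj₁ q≈[] with ≡.trans (≡.sym (coeff-≈ (*-congˡ d q≈[]) 0)) (qd≈1 0)
...   | ()
positive-degree⇒¬∣1 {suc n} {d} (d<1+n , dₙ≡1) _ (q , qd≈1) | inj₂ (a , q′ , q′<a , q≈q′+xᵃ)
  with ≡.trans (≡.sym (qd≈1 (a ℕ.+ suc n))) (begin
    coeff (q *ₚ d) (a ℕ.+ suc n)                                   ≡⟨ coeff-≈ (*-congˡ d q≈q′+xᵃ) _ ⟩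
    coeff ((q′ +ₚ X^ a) *ₚ d) (a ℕ.+ suc n)                        ≡⟨ coeff-≈ (distribʳ d q′ (X^ a)) _ ⟩
    coeff (q′ *ₚ d +ₚ X^ a *ₚ d) (a ℕ.+ suc n)                     ≡⟨ coeff-+ (q′ *ₚ d) (X^ a *ₚ d) _ ⟩
    coeff (q′ *ₚ d) (a ℕ.+ suc n) xor coeff (X^ a *ₚ d) (a ℕ.+ suc n)
      ≡⟨ cong₂ _xor_ (DegreeBelow-* q′ q′<a d<1+n ℕ.≤-refl) (≡.trans (coeff-X^* a d (suc n)) dₙ≡1) ⟩
    true                                                           ∎)
  where open ≡.≡-Reasoning
... | 0≡1 rewrite ℕ.+-suc a n with 0≡1
... | ()

Φ₃∘ₚX^-degree : ∀ g → 1 ≤ g → HasDegree (g ℕ.* 2) (Φ₃ ∘ₚ X^ g)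
Φ₃∘ₚX^-degree g@(suc _) _ =
  HasDegree-resp (≈-sym Φ₃[xᵍ]≈1+xᵍ+x²ᵍ)
    (HasDegree-+ {f = X^ (g ℕ.* 0) +ₚ X^ (g ℕ.* 1)}
      (DegreeBelow-+ {f = X^ (g ℕ.* 0)} (DegreeBelow-X^ (ℕ.*-monoʳ-< g (s≤s z≤n)))
                                        (DegreeBelow-X^ (ℕ.*-monoʳ-< g (s≤s (s≤s z≤n)))))
      (HasDegree-X^ (g ℕ.* 2)))
  where
  Φ₃[xᵍ]≈1+xᵍ+x²ᵍ : Φ₃ ∘ₚ X^ g ≈ X^ (g ℕ.* 0) +ₚ X^ (g ℕ.* 1) +ₚ X^ (g ℕ.* 2)
  Φ₃[xᵍ]≈1+xᵍ+x²ᵍ = begin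
    Φ₃ ∘ₚ X^ g
      ≈⟨ ∘ₚ-congˡ (X^ g) (≈-compute Φ₃ (X^ 0 +ₚ X^ 1 +ₚ X^ 2) _) ⟩
    (X^ 0 +ₚ X^ 1 +ₚ X^ 2) ∘ₚ X^ g                      ≈⟨ +-∘ₚ (X^ 0 +ₚ X^ 1) (X^ 2) (X^ g) ⟩
    (X^ 0 +ₚ X^ 1) ∘ₚ X^ g +ₚ X^ 2 ∘ₚ X^ g              ≈⟨ +-cong (+-∘ₚ (X^ 0) (X^ 1) (X^ g)) (X^∘ₚX^ 2 g) ⟩
    X^ 0 ∘ₚ X^ g +ₚ X^ 1 ∘ₚ X^ g +ₚ X^ (g ℕ.* 2)        ≈⟨ +-congʳ (+-cong (X^∘ₚX^ 0 g) (X^∘ₚX^ 1 g)) ⟩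
    X^ (g ℕ.* 0) +ₚ X^ (g ℕ.* 1) +ₚ X^ (g ℕ.* 2)        ∎
    where open ≈-Reasoning

c[xᵏ]∈I∧xᵐ-1∈I⇒1∈I : ∀ I {m k N} → 6 ≤ m → m ∣ k ℕ.* N → ¬ 3 ∣ N →
  compX^ k (cPoly m (1 ∷ 2 ∷ 5 ∷ 6 ∷ [])) ∈ I → xm-1 m ∈ I → oneₚ ∈ I
c[xᵏ]∈I∧xᵐ-1∈I⇒1∈I I {m} {k} {N} 6≤m m∣kN ¬3∣N c[xᵏ]∈I xᵐ-1∈I =
  Φ₃³Φ₉-root⇒1∈I I (X^ k) (X^a^n≋1 k N (mk≋ xᵐ-1∈I) m∣kN) ¬3∣N
    (Equivalence.to (c[p]∈I⇔Φ₃³Φ₉[p]∈I (X^ k) (X^a^n≋1 k m (mk≋ xᵐ-1∈I) (n∣m*n k)) 6≤m) c[xᵏ]∈I)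
  where open ModuloIdeal I

Φ₃[xᵍ]∈I⇒c[xᵏ]∈I×xᵐ-1∈I : ∀ I {m k g K} → 6 ≤ m → 3 ℕ.* g ∣ m → k ≡ K ℕ.* g → ¬ 3 ∣ K →
  Φ₃ ∘ₚ X^ g ∈ I → compX^ k (cPoly m (1 ∷ 2 ∷ 5 ∷ 6 ∷ [])) ∈ I × xm-1 m ∈ I
Φ₃[xᵍ]∈I⇒c[xᵏ]∈I×xᵐ-1∈I I {m} {k} {g} {K} 6≤m 3g∣m k≡Kg ¬3∣K Φ₃[z]∈I =
  Equivalence.from (c[p]∈I⇔Φ₃³Φ₉[p]∈I y (X^a^n≋1 k m xᵐ≋1 (n∣m*n k)) 6≤m) Φ₃³Φ₉[y]∈I ,
  _≋_mod_.difference∈ xᵐ≋1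
  where
  open ModuloIdeal I
  open Ideal I using (∈-resp; *-closed)
  module Q = CommutativeRing (quotientRing I)
  z = X^ g
  y = X^ k
  xᵍ³≋1 : X ^ (g ℕ.* 3) ≋ oneₚ mod I
  xᵍ³≋1 = Q.trans (≈⇒≋ I (≈-sym (≈-trans (X^-^ g 3) (X^≈X^ (g ℕ.* 3))))) (Φ₃-root⇒x³≋1 z Φ₃[z]∈I)
  xᵐ≋1 : X^ m ≋ oneₚ mod I
  xᵐ≋1 = Q.trans (≈⇒≋ I (X^≈X^ m))
           (x^m≋1∧m∣n⇒x^n≋1 {X} xᵍ³≋1 (≡.subst (_∣ m) (ℕ.*-comm 3 g) 3g∣m))
  y≈zᴷ : y ≈ z ^ K
  y≈zᴷ = ≈-sym (≈-trans (X^-^ g K) (≈-reflexive (≡.cong X^ (≡.trans (ℕ.*-comm g K) (≡.sym k≡Kg)))))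
  Φ₃[y]∈I : Φ₃ ∘ₚ y ∈ I
  Φ₃[y]∈I = ∈-resp (∘ₚ-congʳ Φ₃ (≈-sym y≈zᴷ)) (Φ₃-root⇒Φ₃-root-^ z Φ₃[z]∈I ¬3∣K)
  Φ₃³Φ₉[y]∈I : Φ₃³Φ₉ ∘ₚ y ∈ I
  Φ₃³Φ₉[y]∈I = ∈-resp (≈-trans (*-comm _ (Φ₃ ∘ₚ y)) (≈-sym (*-∘ₚ Φ₃ (Φ₃ *ₚ (Φ₃ *ₚ Φ₉)) y)))
                      (*-closed ((Φ₃ *ₚ (Φ₃ *ₚ Φ₉)) ∘ₚ y) Φ₃[y]∈I)

∣ₚ⇒∈multiples : ∀ {d f} → d ∣ₚ f → f ∈ multiples d
∣ₚ⇒∈multiples (q , qd≈f) = q , mk≈ qd≈f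

∈multiples⇒∣ₚ : ∀ {d f} → f ∈ multiples d → d ∣ₚ f
∈multiples⇒∣ₚ (q , qd≈f) = q , coeff-≈ qd≈f

open import Data.Nat using (_*_)

¬3g∣g : ∀ g .{{_ : NonZero g}} → ¬ (3 * g ∣ g)
¬3g∣g g 3g∣g = ℕ.<⇒≱ (≡.subst (g ℕ.<_) (ℕ.*-comm g 3) (ℕ.m<m*n g 3 (s≤s (s≤s z≤n)))) (∣⇒≤ 3g∣g)

3gcd[m,k]∣m⇒gcd[m,3k]≢gcd[m,k] : ∀ m k → gcd m k ≢ 0 → 3 * gcd m k ∣ m → gcd m (3 * k) ≢ gcd m k
3gcd[m,k]∣m⇒gcd[m,3k]≢gcd[m,k] m k g≢0 3g∣m G≡g =
  ¬3g∣g (gcd m k) {{≢-nonZero g≢0}}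
    (≡.subst (3 * gcd m k ∣_) G≡g (gcd-greatest 3g∣m (*-monoʳ-∣ 3 (gcd[m,n]∣n m k))))

gcd[m,3k]≢gcd[m,k]⇒3gcd[m,k]∣m : ∀ m k → gcd m (3 * k) ≢ gcd m k → 3 * gcd m k ∣ m
gcd[m,3k]≢gcd[m,k]⇒3gcd[m,k]∣m m k G≢g = [ u≡1⇒3g∣m , u≡3⇒3g∣m ]′ (prime⇒irreducible (from-yes (prime? 3)) u∣3)
  where
  g = gcd m k
  G = gcd m (3 * k)
  g∣G : g ∣ G
  g∣G = gcd-greatest (gcd[m,n]∣m m k) (∣n⇒∣m*n 3 (gcd[m,n]∣n m k))
  u = _∣_.quotient g∣G
  G≡ug : G ≡ u * g
  G≡ug = _∣_.equality g∣G
  g≢0 : g ≢ 0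
  g≢0 g≡0 = G≢g (≡.trans G≡ug (≡.trans (≡.cong (u *_) g≡0) (≡.trans (ℕ.*-zeroʳ u) (≡.sym g≡0))))
  G∣3g : G ∣ 3 * g
  G∣3g = ≡.subst (G ∣_) (≡.sym (c*gcd[m,n]≡gcd[cm,cn] 3 m k))
           (gcd-greatest (∣n⇒∣m*n 3 (gcd[m,n]∣m m (3 * k))) (gcd[m,n]∣n m (3 * k)))
  u∣3 : u ∣ 3
  u∣3 = *-cancelʳ-∣ g {{≢-nonZero g≢0}} (≡.subst (_∣ 3 * g) G≡ug G∣3g)
  u≡1⇒3g∣m : u ≡ 1 → 3 * g ∣ m
  u≡1⇒3g∣m u≡1 = ⊥-elim (G≢g (≡.trans G≡ug (≡.trans (≡.cong (_* g) u≡1) (ℕ.*-identityˡ g))))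
  u≡3⇒3g∣m : u ≡ 3 → 3 * g ∣ m
  u≡3⇒3g∣m u≡3 = ≡.subst (_∣ m) (≡.trans G≡ug (≡.cong (_* g) u≡3)) (gcd[m,n]∣m m (3 * k))

gcd[m,3k]≡gcd[m,k]⇒coprime : ∀ m k → 6 ≤ m → gcd m (3 * k) ≡ gcd m k →
  GcdOne (compX^ k (cPoly m (1 ∷ 2 ∷ 5 ∷ 6 ∷ []))) (xm-1 m)
gcd[m,3k]≡gcd[m,k]⇒coprime m k 6≤m G≡g d d∣c[xᵏ] d∣xᵐ-1 =
  ∈multiples⇒∣ₚ (c[xᵏ]∈I∧xᵐ-1∈I⇒1∈I (multiples d) {m} {k} 6≤m m∣kN ¬3∣N
                   (∣ₚ⇒∈multiples d∣c[xᵏ]) (∣ₚ⇒∈multiples d∣xᵐ-1))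
  where
  g = gcd m k
  N = _∣_.quotient (gcd[m,n]∣m m k)
  m≡Ng : m ≡ N * g
  m≡Ng = _∣_.equality (gcd[m,n]∣m m k)
  g≢0 : g ≢ 0
  g≢0 = gcd[m,n]≢0 m k (inj₁ (ℕ.>⇒≢ (ℕ.<-≤-trans (s≤s z≤n) 6≤m)))
  ¬3∣N : ¬ 3 ∣ N
  ¬3∣N 3∣N = 3gcd[m,k]∣m⇒gcd[m,3k]≢gcd[m,k] m k g≢0 (≡.subst (3 * g ∣_) (≡.sym m≡Ng) (*-monoˡ-∣ g 3∣N)) G≡g
  m∣kN : m ∣ k * N
  m∣kN = ≡.subst₂ _∣_ (≡.sym m≡Ng) (ℕ.*-comm N k) (*-monoʳ-∣ N (gcd[m,n]∣n m k))

gcd[m,3k]≢gcd[m,k]⇒¬coprime : ∀ m k → 6 ≤ m → gcd m (3 * k) ≢ gcd m k →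
  ¬ GcdOne (compX^ k (cPoly m (1 ∷ 2 ∷ 5 ∷ 6 ∷ []))) (xm-1 m)
gcd[m,3k]≢gcd[m,k]⇒¬coprime m k 6≤m G≢g coprime =
  positive-degree⇒¬∣1 (Φ₃∘ₚX^-degree g 1≤g) (ℕ.≤-trans 1≤g (ℕ.m≤m*n g 2))
    (coprime d (∈multiples⇒∣ₚ c[xᵏ]∈I) (∈multiples⇒∣ₚ xᵐ-1∈I))
  where
  g = gcd m k
  d = Φ₃ ∘ₚ X^ g
  K = _∣_.quotient (gcd[m,n]∣n m k)
  k≡Kg : k ≡ K * g
  k≡Kg = _∣_.equality (gcd[m,n]∣n m k)
  3g∣m : 3 * g ∣ m
  3g∣m = gcd[m,3k]≢gcd[m,k]⇒3gcd[m,k]∣m m k G≢g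
  g≢0 : g ≢ 0
  g≢0 = gcd[m,n]≢0 m k (inj₁ (ℕ.>⇒≢ (ℕ.<-≤-trans (s≤s z≤n) 6≤m)))
  1≤g : 1 ≤ g
  1≤g = ℕ.n≢0⇒n>0 g≢0
  ¬3∣K : ¬ 3 ∣ K
  ¬3∣K 3∣K = ¬3g∣g g {{≢-nonZero g≢0}}
    (gcd-greatest 3g∣m (≡.subst (3 * g ∣_) (≡.sym k≡Kg) (*-monoˡ-∣ g 3∣K)))
  c[xᵏ]∈I×xᵐ-1∈I = Φ₃[xᵍ]∈I⇒c[xᵏ]∈I×xᵐ-1∈I (multiples d) 6≤m 3g∣m k≡Kg ¬3∣K (oneₚ , *-identityˡ d)
  c[xᵏ]∈I = proj₁ c[xᵏ]∈I×xᵐ-1∈I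
  xᵐ-1∈I = proj₂ c[xᵏ]∈I×xᵐ-1∈I

proposition4 : (m k : ℕ) → 13 ≤ m → 1 ≤ k →
    (GcdOne (compX^ k (cPoly m (1 ∷ 2 ∷ 5 ∷ 6 ∷ []))) (xm-1 m) → gcd m (3 * k) ≡ gcd m k)
    × (gcd m (3 * k) ≡ gcd m k → GcdOne (compX^ k (cPoly m (1 ∷ 2 ∷ 5 ∷ 6 ∷ []))) (xm-1 m))
proposition4 m k 13≤m _ =
  (λ coprime → decidable-stable (gcd m (3 * k) ℕ.≟ gcd m k)
                 (λ G≢g → gcd[m,3k]≢gcd[m,k]⇒¬coprime m k 6≤m G≢g coprime))
  , gcd[m,3k]≡gcd[m,k]⇒coprime m k 6≤m
  where
  6≤m : 6 ≤ m
  6≤m = ℕ.≤-trans (ℕ.m≤m+n 6 7) 13≤m
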